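{- Assume the following statement (Conjecture 1): for every positive integer $n$ and every system $\mathcal{S} \subseteq G_n$, if $\mathcal{S}$ has only finitely many solutions in rationals $x_1,\ldots,x_n$, then each such solution satisfies $h(x_1,\ldots,x_n) \leqslant 1$ if $n=1$ and $h(x_1,\ldots,x_n) \leqslant 2^{2^{n-2}}$ if $n \geqslant 2$. Then there is an algorithm which takes as input a Diophantine equation, returns an integer, and this integer is greater than the heights of all rational solutions of the equation whenever the set of its rational solutions is finite.
   Context: The height of a rational number $\frac{p}{q}$ written in lowest terms is $h\left(\frac{p}{q}\right)=\max(|p|,|q|)$; the height of a rational tuple is $h(x_1,\ldots,x_n)=\max(h(x_1),\ldots,h(x_n))$. For a positive integer $n$, $G_n=\{x_i+1=x_k: i,k \in \{1,\ldots,n\}\} \cup \{x_i \cdot x_j=x_k: i,j,k \in \{1,\ldots,n\}\}$; a system $\mathcal{S}\subseteq G_n$ is a set of such equations in the variables $x_1,\ldots,x_n$. A Diophantine equation is an equation $D(x_1,\ldots,x_p)=0$ with $D \in \mathbb{Z}[x_1,\ldots,x_p]$. -}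

module Defs where

open import Data.Nat using (ℕ; zero; suc; _⊔_; _^_; _≤_)
open import Data.Integer as ℤ using (ℤ; +_)
open import Data.Rational as ℚ using (ℚ; 0ℚ; 1ℚ; _+_; _*_)
open import Data.Fin using (Fin)
open import Data.Vec using (Vec; []; _∷_; lookup)
open import Data.List using (List)
open import Data.List.Membership.Propositional using (_∈_)
open import Data.List.Relation.Unary.All using (All)
open import Data.Product using (Σ)
open import Relation.Binary.PropositionalEquality using (_≡_)

-- Height of a rational p/q in lowest terms (stdlib ℚ is normalised): max(|p|,|q|)
height : ℚ → ℕ
height r = ℤ.∣ ℚ.numerator r ∣ ⊔ ℚ.denominatorℕ r

heightTuple : ∀ {n} → Vec ℚ n → ℕ
heightTuple []       = 0
heightTuple (x ∷ xs) = height x ⊔ heightTuple xs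

data GEq (n : ℕ) : Set where
  addOne : (i k : Fin n) → GEq n
  mulEq  : (i j k : Fin n) → GEq n

SatG : ∀ {n} → Vec ℚ n → GEq n → Set
SatG x (addOne i k)  = lookup x i + 1ℚ ≡ lookup x k
SatG x (mulEq i j k) = lookup x i * lookup x j ≡ lookup x k

-- A system S ⊆ G_n (G_n is finite, so S is given as a finite list of equations)
System : ℕ → Set
System n = List (GEq n)

SolvesSystem : ∀ {n} → System n → Vec ℚ n → Set
SolvesSystem S x = All (SatG x) S

FiniteSet : ∀ {n} → (Vec ℚ n → Set) → Set
FiniteSet {n} P = Σ (List (Vec ℚ n)) λ L → ∀ x → P x → x ∈ L

conjBound : ℕ → ℕ
conjBound 0             = 1
conjBound 1             = 1
conjBound (suc (suc m)) = 2 ^ (2 ^ m)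

Conjecture1 : Set
Conjecture1 = (n : ℕ) → 1 ≤ n → (S : System n) →
  FiniteSet (SolvesSystem S) →
  ∀ x → SolvesSystem S x → heightTuple x ≤ conjBound n

-- Polynomials in ℤ[x_1,…,x_p], given syntactically (input format of the algorithm)
data Poly (p : ℕ) : Set where
  const : ℤ → Poly p
  var   : Fin p → Poly p
  _⊕_   : Poly p → Poly p → Poly p
  _⊗_   : Poly p → Poly p → Poly p

evalℚ : ∀ {p} → Poly p → Vec ℚ p → ℚ
evalℚ (const c) x = c ℚ./ 1
evalℚ (var i)   x = lookup x i
evalℚ (f ⊕ g)   x = evalℚ f x + evalℚ g x
evalℚ (f ⊗ g)   x = evalℚ f x * evalℚ g x

DiophEq : Set
DiophEq = Σ ℕ Poly

RatSolution : (D : DiophEq) → Vec ℚ (Data.Product.proj₁ D) → Set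
RatSolution (p Data.Product., D) x = evalℚ D x ≡ 0ℚ

{-# OPTIONS --safe #-}
-- A Diophantine equation D(x₁,…,xₚ) = 0 is compiled into a system S ⊆ G_m whose solutions are
-- exactly the images of the rational roots of D under an injective map ℚ^p → ℚ^m that keeps
-- x₁,…,xₚ among its coordinates. The constants 0 and 1 are pinned down by z·z = z, o·o = o,
-- z + 1 = o; every product in D costs one new variable, and every sum, which G_m cannot express
-- directly, a fixed number of variables obtained by dividing by values that never vanish. If D has
-- finitely many rational roots then S has finitely many solutions, so Conjecture 1 bounds the
-- heights of the roots by conjBound m, and m is computed from D alone.
module Submission where

open import Defs
open import Data.Nat using (ℕ)
open import Data.Integer using (ℤ; +_; _<_)
open import Data.Product using (Σ; proj₁)

open import Data.Nat as ℕ using (zero; suc; s≤s)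
import Data.Nat.Properties as ℕ
open import Data.Nat.Coprimality using (1-coprimeTo) renaming (sym to coprime-sym)
open import Data.Integer as ℤ using (-[1+_])
import Data.Integer.Properties as ℤ
open import Data.Rational as ℚ using (ℚ; 0ℚ; 1ℚ; ½; _+_; _*_; _-_; -_; _÷_; ≢-nonZero)
import Data.Rational.Properties as ℚ
open import Data.Rational.Solver using (module +-*-Solver)
open import Data.Fin using (Fin; zero; suc)
open import Data.Fin.Properties using (nonZeroIndex)
open import Data.Vec using (Vec; []; _∷_; lookup)
open import Data.List using ([]; _∷_; map)
open import Data.List.Relation.Unary.All as All using (All; []; _∷_)
open import Data.List.Relation.Unary.All.Properties using (map⁺; map⁻)
open import Data.List.Membership.Propositional using (_∈_)
open import Data.List.Membership.Propositional.Properties using (∈-map⁺)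
open import Data.Product using (∃; _,_; _×_)
open import Data.Sum using (inj₁; inj₂)
open import Function using (_∘_)
open import Relation.Binary.PropositionalEquality
open +-*-Solver using (solve; _:=_; _:+_; _:*_; _:-_; :-_; con)

p-1+1≡p : ∀ p → (p - 1ℚ) + 1ℚ ≡ p
p-1+1≡p = solve 1 (λ p → (p :- con 1ℚ) :+ con 1ℚ := p) refl

p+1≡q⇒p≡q-1 : ∀ {p q} → p + 1ℚ ≡ q → p ≡ q - 1ℚ
p+1≡q⇒p≡q-1 {p} refl = solve 1 (λ p → p := (p :+ con 1ℚ) :- con 1ℚ) refl p

[0-1]*p≡-p : ∀ p → (0ℚ - 1ℚ) * p ≡ - p
[0-1]*p≡-p = solve 1 (λ p → (con 0ℚ :- con 1ℚ) :* p := :- p) refl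

/1-suc : ∀ k → (+ k ℚ./ 1) + 1ℚ ≡ + suc k ℚ./ 1
/1-suc k = begin
  (+ k ℚ./ 1) + 1ℚ                 ≡⟨ cong (_+ 1ℚ) (ℚ.normalize-coprime (coprime-sym (1-coprimeTo k))) ⟩
  (+ k ℤ.* + 1 ℤ.+ + 1) ℚ./ 1      ≡⟨ cong (λ i → (i ℤ.+ + 1) ℚ./ 1) (ℤ.*-identityʳ (+ k)) ⟩
  (+ k ℤ.+ + 1) ℚ./ 1              ≡⟨ cong (ℚ._/ 1) (ℤ.+-comm (+ k) (+ 1)) ⟩
  + suc k ℚ./ 1                    ∎
  where open ≡-Reasoning

quotient : (a b : ℚ) → b ≢ 0ℚ → ℚ
quotient a b b≢0 = let instance _ = ≢-nonZero b≢0 in a ÷ b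

quotient-* : ∀ a b (b≢0 : b ≢ 0ℚ) → quotient a b b≢0 * b ≡ a
quotient-* a b b≢0 = let instance _ = ≢-nonZero b≢0 in begin
  a * ℚ.1/ b * b     ≡⟨ ℚ.*-assoc a (ℚ.1/ b) b ⟩
  a * (ℚ.1/ b * b)   ≡⟨ cong (a *_) (ℚ.*-inverseˡ b) ⟩
  a * 1ℚ             ≡⟨ ℚ.*-identityʳ a ⟩
  a                  ∎
  where open ≡-Reasoning

quotient-unique : ∀ {v a b} (b≢0 : b ≢ 0ℚ) → v * b ≡ a → v ≡ quotient a b b≢0
quotient-unique {v} {a} {b} b≢0 refl = let instance _ = ≢-nonZero b≢0 in begin
  v                  ≡⟨ ℚ.*-identityʳ v ⟨
  v * 1ℚ             ≡⟨ cong (v *_) (ℚ.*-inverseʳ b) ⟨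
  v * (b * ℚ.1/ b)   ≡⟨ ℚ.*-assoc v b (ℚ.1/ b) ⟨
  v * b * ℚ.1/ b     ∎
  where open ≡-Reasoning

quotient+1-* : ∀ a b (b≢0 : b ≢ 0ℚ) → (quotient a b b≢0 + 1ℚ) * b ≡ a + b
quotient+1-* a b b≢0 =
  trans (distrib (quotient a b b≢0) b) (cong (_+ b) (quotient-* a b b≢0))
  where
    distrib : ∀ q b → (q + 1ℚ) * b ≡ q * b + b
    distrib = solve 2 (λ q b → (q :+ con 1ℚ) :* b := q :* b :+ b) refl

quotient-1-* : ∀ a b (b≢0 : b ≢ 0ℚ) → (quotient a b b≢0 - 1ℚ) * b ≡ a - b
quotient-1-* a b b≢0 =
  trans (distrib (quotient a b b≢0) b) (cong (_- b) (quotient-* a b b≢0))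
  where
    distrib : ∀ q b → (q - 1ℚ) * b ≡ q * b - b
    distrib = solve 2 (λ q b → (q :- con 1ℚ) :* b := q :* b :- b) refl

square-nonNeg : ∀ t → 0ℚ ℚ.≤ t * t
square-nonNeg t with ℚ.≤-total 0ℚ t
... | inj₁ 0≤t = let instance _ = ℚ.nonNegative 0≤t in
  ℚ.nonNegative⁻¹ (t * t) {{ℚ.nonNeg*nonNeg⇒nonNeg t t}}
... | inj₂ t≤0 = let instance _ = ℚ.nonPositive t≤0 in
  ℚ.nonNegative⁻¹ (t * t) {{ℚ.nonPos*nonPos⇒nonPos t t}}

square+pos≢0 : ∀ t {k} → 0ℚ ℚ.< k → t * t + k ≢ 0ℚ
square+pos≢0 t 0<k = ≢-sym (ℚ.<⇒≢ (ℚ.+-mono-≤-< (square-nonNeg t) 0<k))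

square+1≢0 : ∀ y → y * y + 1ℚ ≢ 0ℚ
square+1≢0 y = square+pos≢0 y (ℚ.positive⁻¹ 1ℚ)

-- 4 (y² + y + 1) = (2y + 1)² + 3
pronic+1≢0 : ∀ y → y * (y + 1ℚ) + 1ℚ ≢ 0ℚ
pronic+1≢0 y eq = square+pos≢0 (y + y + 1ℚ) (ℚ.positive⁻¹ three) (begin
  (y + y + 1ℚ) * (y + y + 1ℚ) + three    ≡⟨ complete-square y ⟩
  four * (y * (y + 1ℚ) + 1ℚ)             ≡⟨ cong (four *_) eq ⟩
  four * 0ℚ                              ≡⟨ ℚ.*-zeroʳ four ⟩
  0ℚ                                     ∎)
  where
    open ≡-Reasoning
    three four : ℚ
    three = 1ℚ + 1ℚ + 1ℚ
    four = three + 1ℚ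
    complete-square : ∀ y → (y + y + 1ℚ) * (y + y + 1ℚ) + three ≡ four * (y * (y + 1ℚ) + 1ℚ)
    complete-square = solve 1 (λ y → (y :+ y :+ con 1ℚ) :* (y :+ y :+ con 1ℚ) :+ con three
                                 := con four :* (y :* (y :+ con 1ℚ) :+ con 1ℚ)) refl

-- 2z = (z + 1)² - z² - 1
idempotent∧suc-idempotent⇒0 : ∀ z → z * z ≡ z → (z + 1ℚ) * (z + 1ℚ) ≡ z + 1ℚ → z ≡ 0ℚ
idempotent∧suc-idempotent⇒0 z zz≡z ss≡s = begin
  z                                            ≡⟨ halve z ⟩
  (((z + 1ℚ) * (z + 1ℚ) - z * z) - 1ℚ) * ½      ≡⟨ cong₂ (λ s t → ((s - t) - 1ℚ) * ½) ss≡s zz≡z ⟩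
  (((z + 1ℚ) - z) - 1ℚ) * ½                     ≡⟨ vanish z ⟩
  0ℚ                                           ∎
  where
    open ≡-Reasoning
    halve : ∀ z → z ≡ (((z + 1ℚ) * (z + 1ℚ) - z * z) - 1ℚ) * ½
    halve = solve 1 (λ z → z := (((z :+ con 1ℚ) :* (z :+ con 1ℚ) :- z :* z) :- con 1ℚ) :* con ½) refl
    vanish : ∀ z → (((z + 1ℚ) - z) - 1ℚ) * ½ ≡ 0ℚ
    vanish = solve 1 (λ z → (((z :+ con 1ℚ) :- z) :- con 1ℚ) :* con ½ := con 0ℚ) refl

p+[q*[q+1]+1]-[q*q+1]≡p+q : ∀ p q → (p + (q * (q + 1ℚ) + 1ℚ)) - (q * q + 1ℚ) ≡ p + q
p+[q*[q+1]+1]-[q*q+1]≡p+q =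
  solve 2 (λ p q → (p :+ (q :* (q :+ con 1ℚ) :+ con 1ℚ)) :- (q :* q :+ con 1ℚ) := p :+ q) refl

shiftEq : ∀ {n} → GEq n → GEq (suc n)
shiftEq (addOne i k)  = addOne (suc i) (suc k)
shiftEq (mulEq i j k) = mulEq (suc i) (suc j) (suc k)

module _ {n} {v : ℚ} {y : Vec ℚ n} where

  SatG-shiftEq⁺ : ∀ e → SatG y e → SatG (v ∷ y) (shiftEq e)
  SatG-shiftEq⁺ (addOne i k)  sat = sat
  SatG-shiftEq⁺ (mulEq i j k) sat = sat

  SatG-shiftEq⁻ : ∀ e → SatG (v ∷ y) (shiftEq e) → SatG y e
  SatG-shiftEq⁻ (addOne i k)  sat = sat
  SatG-shiftEq⁻ (mulEq i j k) sat = sat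

  solves-shift⁺ : ∀ {S} → SolvesSystem S y → SolvesSystem (map shiftEq S) (v ∷ y)
  solves-shift⁺ = map⁺ ∘ All.map (SatG-shiftEq⁺ _)

  solves-shift⁻ : ∀ {S} → SolvesSystem (map shiftEq S) (v ∷ y) → SolvesSystem S y
  solves-shift⁻ = All.map (SatG-shiftEq⁻ _) ∘ map⁻

module Encodings (p : ℕ) where

  record Encoding (n : ℕ) : Set where
    field
      system   : System n
      encode   : Vec ℚ p → Vec ℚ n
      sound    : ∀ x → SolvesSystem system (encode x)
      complete : ∀ y → SolvesSystem system y → ∃ λ x → y ≡ encode x
      height-≤ : ∀ x → heightTuple x ℕ.≤ heightTuple (encode x)
  open Encoding public

  record Var {n} (A : Encoding n) (f : Vec ℚ p → ℚ) : Set where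
    constructor var
    field
      index : Fin n
      value : ∀ x → lookup (encode A x) index ≡ f x
  open Var public

  infix 4 _⊑_
  _⊑_ : ∀ {n m} → Encoding n → Encoding m → Set
  A ⊑ B = ∀ {f} → Var A f → Var B f

  ⊑-trans : ∀ {n m k} {A : Encoding n} {B : Encoding m} {C : Encoding k} → A ⊑ B → B ⊑ C → A ⊑ C
  ⊑-trans A⊑B B⊑C v = B⊑C (A⊑B v)

  record Extension {n} (A : Encoding n) (f : Vec ℚ p → ℚ) : Set where
    constructor ext
    field
      {size}   : ℕ
      {target} : Encoding size
      lift     : A ⊑ target
      result   : Var target f
  open Extension public

  pure : ∀ {n} {A : Encoding n} {f} → Var A f → Extension A f
  pure = ext (λ v → v)

  _>>=_ : ∀ {n} {A : Encoding n} {f g} →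
          (e : Extension A f) → ((e : Extension A f) → Extension (target e) g) → Extension A g
  e >>= k = ext (⊑-trans (lift e) (lift (k e))) (result (k e))

  Extension-resp-≗ : ∀ {n} {A : Encoding n} {f g} → f ≗ g → Extension A f → Extension A g
  Extension-resp-≗ f≗g (ext ↑ (var i val)) = ext ↑ (var i (λ x → trans (val x) (f≗g x)))

  adjoin : ∀ {n} (A : Encoding n) (e : GEq (suc n)) (f : Vec ℚ p → ℚ) →
           (∀ x → SatG (f x ∷ encode A x) e) →
           (∀ x v → SatG (v ∷ encode A x) e → v ≡ f x) →
           Extension A f
  adjoin A e f sat determined = ext {target = A′} (λ (var i val) → var (suc i) val) (var zero (λ _ → refl))
    where
      complete′ : ∀ y → SolvesSystem (e ∷ map shiftEq (system A)) y → ∃ λ x → y ≡ f x ∷ encode A x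
      complete′ (v ∷ y) (sat-e ∷ sat-A) with complete A y (solves-shift⁻ sat-A)
      ... | x , refl = x , cong (_∷ encode A x) (determined x v sat-e)

      A′ : Encoding (suc _)
      A′ = record
        { system   = e ∷ map shiftEq (system A)
        ; encode   = λ x → f x ∷ encode A x
        ; sound    = λ x → sat x ∷ solves-shift⁺ (sound A x)
        ; complete = complete′
        ; height-≤ = λ x → ℕ.≤-trans (height-≤ A x) (ℕ.m≤n⊔m _ _)
        }

  module _ {n} {A : Encoding n} {f g : Vec ℚ p → ℚ} where

    adjoin-* : Var A f → Var A g → Extension A (λ x → f x * g x)
    adjoin-* (var i vi) (var j vj) =
      adjoin A (mulEq (suc i) (suc j) zero) _ sat (λ x v eq → trans (sym eq) (sat x))
      where
        sat : ∀ x → lookup (encode A x) i * lookup (encode A x) j ≡ f x * g x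
        sat x = cong₂ _*_ (vi x) (vj x)

    adjoin-÷ : Var A f → Var A g → (g≢0 : ∀ x → g x ≢ 0ℚ) → Extension A (λ x → quotient (f x) (g x) (g≢0 x))
    adjoin-÷ (var i vi) (var j vj) g≢0 = adjoin A (mulEq zero (suc j) (suc i)) _ sat determined
      where
        f/g : Vec ℚ p → ℚ
        f/g x = quotient (f x) (g x) (g≢0 x)

        sat : ∀ x → f/g x * lookup (encode A x) j ≡ lookup (encode A x) i
        sat x = trans (cong (f/g x *_) (vj x)) (trans (quotient-* (f x) (g x) (g≢0 x)) (sym (vi x)))

        determined : ∀ x v → v * lookup (encode A x) j ≡ lookup (encode A x) i → v ≡ f/g x
        determined x v eq = quotient-unique (g≢0 x) (trans (cong (v *_) (sym (vj x))) (trans eq (vi x)))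

  module _ {n} {A : Encoding n} {f : Vec ℚ p → ℚ} where

    adjoin-suc : Var A f → Extension A (λ x → f x + 1ℚ)
    adjoin-suc (var i vi) = adjoin A (addOne (suc i) zero) _ sat (λ x v eq → trans (sym eq) (sat x))
      where
        sat : ∀ x → lookup (encode A x) i + 1ℚ ≡ f x + 1ℚ
        sat x = cong (_+ 1ℚ) (vi x)

    adjoin-pred : Var A f → Extension A (λ x → f x - 1ℚ)
    adjoin-pred (var i vi) = adjoin A (addOne zero (suc i)) _
      (λ x → trans (p-1+1≡p (f x)) (sym (vi x)))
      (λ x v eq → p+1≡q⇒p≡q-1 (trans eq (vi x)))

  module _ {n} {A : Encoding n} {f g : Vec ℚ p → ℚ} (g≢0 : ∀ x → g x ≢ 0ℚ) where

    adjoin-+-nonzero : Var A f → Var A g → Extension A (λ x → f x + g x)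
    adjoin-+-nonzero a b = Extension-resp-≗ (λ x → quotient+1-* (f x) (g x) (g≢0 x)) do
      ext ↑₁ q   ← adjoin-÷ a b g≢0
      ext ↑₂ q+1 ← adjoin-suc q
      adjoin-* q+1 (↑₂ (↑₁ b))

    adjoin-−-nonzero : Var A f → Var A g → Extension A (λ x → f x - g x)
    adjoin-−-nonzero a b = Extension-resp-≗ (λ x → quotient-1-* (f x) (g x) (g≢0 x)) do
      ext ↑₁ q   ← adjoin-÷ a b g≢0
      ext ↑₂ q-1 ← adjoin-pred q
      adjoin-* q-1 (↑₂ (↑₁ b))

  module _ {n} {A : Encoding n} {g : Vec ℚ p → ℚ} where

    adjoin-square+1 : Var A g → Extension A (λ x → g x * g x + 1ℚ)
    adjoin-square+1 b = do
      ext _ s ← adjoin-* b b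
      adjoin-suc s

    adjoin-pronic+1 : Var A g → Extension A (λ x → g x * (g x + 1ℚ) + 1ℚ)
    adjoin-pronic+1 b = do
      ext ↑₁ b+1 ← adjoin-suc b
      ext ↑₂ t   ← adjoin-* (↑₁ b) b+1
      adjoin-suc t

  -- G_n has no addition, but f + g is (f + n₁) − n₂ for the never-vanishing n₁ = g² + g + 1, n₂ = g² + 1.
  adjoin-+ : ∀ {n} {A : Encoding n} {f g} → Var A f → Var A g → Extension A (λ x → f x + g x)
  adjoin-+ {f = f} {g} a b = Extension-resp-≗ (λ x → p+[q*[q+1]+1]-[q*q+1]≡p+q (f x) (g x)) do
    ext ↑₁ n₁ ← adjoin-pronic+1 b
    ext ↑₂ s  ← adjoin-+-nonzero (pronic+1≢0 ∘ g) (↑₁ a) n₁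
    ext ↑₃ n₂ ← adjoin-square+1 (↑₂ (↑₁ b))
    adjoin-−-nonzero (square+1≢0 ∘ g) (↑₃ s) n₂

  base : Encoding (suc (suc p))
  base = record
    { system   = constants
    ; encode   = λ x → 0ℚ ∷ 1ℚ ∷ x
    ; sound    = λ x → refl ∷ refl ∷ refl ∷ []
    ; complete = complete′
    ; height-≤ = λ x → ℕ.≤-trans (ℕ.m≤n⊔m (height 1ℚ) _) (ℕ.m≤n⊔m (height 0ℚ) _)
    }
    where
      constants : System (suc (suc p))
      constants = mulEq zero zero zero ∷ mulEq (suc zero) (suc zero) (suc zero) ∷ addOne zero (suc zero) ∷ []

      complete′ : ∀ y → SolvesSystem constants y → ∃ λ x → y ≡ 0ℚ ∷ 1ℚ ∷ x
      complete′ (z ∷ o ∷ x) (zz≡z ∷ oo≡o ∷ refl ∷ []) =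
        x , cong (λ z → z ∷ z + 1ℚ ∷ x) (idempotent∧suc-idempotent⇒0 z zz≡z oo≡o)

  zeroVar : Var base (λ _ → 0ℚ)
  zeroVar = var zero (λ _ → refl)

  oneVar : Var base (λ _ → 1ℚ)
  oneVar = var (suc zero) (λ _ → refl)

  inputVar : (i : Fin p) → Var base (λ x → lookup x i)
  inputVar i = var (suc (suc i)) (λ _ → refl)

  module _ {n} {A : Encoding n} (base⊑A : base ⊑ A) where

    adjoin-ℕ : (k : ℕ) → Extension A (λ _ → + k ℚ./ 1)
    adjoin-ℕ zero    = pure (base⊑A zeroVar)
    adjoin-ℕ (suc k) = Extension-resp-≗ (λ _ → /1-suc k) do
      ext _ v ← adjoin-ℕ k
      adjoin-suc v

    adjoin-ℤ : (c : ℤ) → Extension A (λ _ → c ℚ./ 1)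
    adjoin-ℤ (+ k)    = adjoin-ℕ k
    adjoin-ℤ -[1+ k ] = Extension-resp-≗ (λ _ → [0-1]*p≡-p (+ suc k ℚ./ 1)) do
      ext ↑₁ v         ← adjoin-ℕ (suc k)
      ext ↑₂ minus-one ← adjoin-pred (↑₁ (base⊑A zeroVar))
      adjoin-* minus-one (↑₂ v)

  compile : ∀ {n} {A : Encoding n} → base ⊑ A → (P : Poly p) → Extension A (evalℚ P)
  compile base⊑A (const c) = adjoin-ℤ base⊑A c
  compile base⊑A (var i)   = pure (base⊑A (inputVar i))
  compile base⊑A (P ⊕ Q)   = do
    ext ↑₁ a ← compile base⊑A P
    ext ↑₂ b ← compile (⊑-trans base⊑A ↑₁) Q
    adjoin-+ (↑₂ a) b
  compile base⊑A (P ⊗ Q)   = do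
    ext ↑₁ a ← compile base⊑A P
    ext ↑₂ b ← compile (⊑-trans base⊑A ↑₁) Q
    adjoin-* (↑₂ a) b

  module _ {n} {A : Encoding n} {f} (r : Var A f) (one : Var A (λ _ → 1ℚ)) where

    zeroSystem : System n
    zeroSystem = addOne (index r) (index one) ∷ system A

    zeroSystem-sound : ∀ x → f x ≡ 0ℚ → SolvesSystem zeroSystem (encode A x)
    zeroSystem-sound x fx≡0 =
      trans (cong (_+ 1ℚ) (trans (value r x) fx≡0)) (sym (value one x)) ∷ sound A x

    zeroSystem-complete : ∀ y → SolvesSystem zeroSystem y → ∃ λ x → f x ≡ 0ℚ × y ≡ encode A x
    zeroSystem-complete y (r+1≡one ∷ sat) with complete A y sat
    ... | x , refl = x , p+1≡q⇒p≡q-1 fx+1≡1 , refl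
      where
        fx+1≡1 : f x + 1ℚ ≡ 1ℚ
        fx+1≡1 = trans (cong (_+ 1ℚ) (sym (value r x))) (trans r+1≡one (value one x))

    zeroSystem-finite : FiniteSet (λ x → f x ≡ 0ℚ) → FiniteSet (SolvesSystem zeroSystem)
    zeroSystem-finite (roots , roots-listed) = map (encode A) roots , listed
      where
        listed : ∀ y → SolvesSystem zeroSystem y → y ∈ map (encode A) roots
        listed y sat with zeroSystem-complete y sat
        ... | x , fx≡0 , refl = ∈-map⁺ (encode A) (roots-listed x fx≡0)

module _ {p} (P : Poly p) where
  open Encodings p

  private
    compiled : Extension base (evalℚ P)
    compiled = compile (λ v → v) P

  encodingSize : ℕ
  encodingSize = size compiled

  root-height-≤ : Conjecture1 → FiniteSet (λ x → evalℚ P x ≡ 0ℚ) →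
                  ∀ x → evalℚ P x ≡ 0ℚ → heightTuple x ℕ.≤ conjBound encodingSize
  root-height-≤ conjecture finite x root = ℕ.≤-trans (height-≤ B x)
    (conjecture encodingSize 1≤size (zeroSystem r one) (zeroSystem-finite r one finite)
                (encode B x) (zeroSystem-sound r one x root))
    where
      B : Encoding encodingSize
      B = target compiled

      r : Var B (evalℚ P)
      r = result compiled

      one : Var B (λ _ → 1ℚ)
      one = lift compiled oneVar

      1≤size : 1 ℕ.≤ encodingSize
      1≤size = ℕ.>-nonZero⁻¹ encodingSize {{nonZeroIndex (index r)}}

heightBound : DiophEq → ℤ
heightBound (_ , P) = + suc (conjBound (encodingSize P))

theorem2 : Conjecture1 →
    Σ (DiophEq → ℤ) λ alg →
    ∀ D → FiniteSet (RatSolution D) →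
    ∀ x → RatSolution D x → + heightTuple {proj₁ D} x < alg D
theorem2 conjecture = heightBound , λ where
  (_ , P) finite x root → ℤ.+<+ (s≤s (root-height-≤ P conjecture finite x root))
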